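{- For every integer $p\ge2$, there exists an $\alpha_2$-metric graph $G_p$ with $4p$ vertices containing a metric triangle $x_0y_{p-1}z_{p-1}$ such that $d(x_0,y_{p-1})=d(x_0,z_{p-1})=p\ge2=d(y_{p-1},z_{p-1})$. In particular, there is no constant upper bound on the side-lengths of metric triangles in $\alpha_2$-metric graphs.
   Context: All graphs are finite, undirected, unweighted, simple and connected; $d$ is the shortest-path distance, $I(u,v)=\{z : d(u,v)=d(u,z)+d(z,v)\}$ and $I^o(u,v)=I(u,v)\setminus\{u,v\}$. A graph is $\alpha_2$-metric if for all vertices $u,v,w,x$ with $v\in I(u,w)$, $w\in I(v,x)$ and $v,w$ adjacent, $d(u,x)\ge d(u,v)+d(v,x)-2$. A metric triangle is a triple of vertices $u,v,w$ such that $I^o(u,v)$, $I^o(v,w)$, $I^o(w,u)$ are pairwise disjoint; its side-lengths are $d(u,v),d(v,w),d(w,u)$. -}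

module Defs where

open import Data.Nat using (ℕ; zero; suc; _+_; _≤_)
open import Data.Fin using (Fin)
open import Data.Product using (Σ; ∃; _×_; _,_)
open import Data.Empty using (⊥)
open import Relation.Nullary using (¬_; Dec)
open import Relation.Binary.PropositionalEquality using (_≡_; _≢_)

record Graph (n : ℕ) : Set₁ where
  field
    Adj     : Fin n → Fin n → Set
    adj?    : ∀ u v → Dec (Adj u v)
    sym     : ∀ {u v} → Adj u v → Adj v u
    irrefl  : ∀ {u} → ¬ Adj u u
open Graph public

module _ {n : ℕ} (G : Graph n) where

  data Walk : Fin n → Fin n → ℕ → Set where
    [] : ∀ {u} → Walk u u 0
    _∷_ : ∀ {u w v k} → Adj G u w → Walk w v k → Walk u v (suc k)

  Connected : Set
  Connected = ∀ u v → ∃ λ k → Walk u v k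

  Dist : Fin n → Fin n → ℕ → Set
  Dist u v k = Walk u v k × (∀ m → Walk u v m → k ≤ m)

  InI : Fin n → Fin n → Fin n → Set
  InI u v z = Σ ℕ λ a → Σ ℕ λ b → Σ ℕ λ c →
                Dist u v a × Dist u z b × Dist z v c × a ≡ b + c

  InIo : Fin n → Fin n → Fin n → Set
  InIo u v z = InI u v z × z ≢ u × z ≢ v

  Alpha2Metric : Set
  Alpha2Metric = ∀ u v w x → InI u w v → InI v x w → Adj G v w →
                 ∀ a b c → Dist u x a → Dist u v b → Dist v x c →
                 b + c ≤ a + 2

  Disjoint : (Fin n → Set) → (Fin n → Set) → Set
  Disjoint P Q = ∀ z → P z → Q z → ⊥

  MetricTriangle : Fin n → Fin n → Fin n → Set
  MetricTriangle u v w =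
    Disjoint (InIo u v) (InIo v w) ×
    Disjoint (InIo v w) (InIo w u) ×
    Disjoint (InIo w u) (InIo u v)

-- Gₚ consists of an apex x₀, two paths y₀ … y_{p-1} and z₀ … z_{p-1} hanging from it, and a
-- middle path m₀ m₁ … in which m_l is adjacent to y_l, y_{l+1}, z_l and z_{l+1}. With heights
-- h(x₀) = 0, h(y_i) = h(z_i) = 2i + 2 and h(m_l) = 2l + 3, the distance is ⌈|Δh| / 2⌉, except
-- that y_i and z_j are at distance 1 + max(|i - j|, 1). So 2d exceeds |Δh| by at most 2, the
-- only exception being the twins y_i, z_i of equal height, at distance 2.
-- In the α₂ condition for an edge vw, v ∈ I(u,w) forces h(v) to lie between h(u) and h(w) unless
-- d(u,v) ≤ 1, and likewise w ∈ I(v,x). Once the heights of u, v, w, x are monotone,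
-- 2 (d(u,v) + d(v,x)) ≤ |h(u) - h(x)| + 4 ≤ 2 d(u,x) + 4.
-- Geodesics from x₀ to y_{p-1} stay on the y-path, those to z_{p-1} on the z-path, and no vertex
-- of one path is adjacent to a vertex of the other, so x₀ y_{p-1} z_{p-1} is a metric triangle.
module Submission where

open import Defs hiding (sym)
open import Data.Nat
open import Data.Nat.Properties
open import Data.Nat.Tactic.RingSolver using (solve-∀)
open import Data.Fin using (Fin; toℕ; fromℕ<; splitAt; join)
open import Data.Fin.Properties using (toℕ<n; toℕ-fromℕ<; fromℕ<-toℕ; splitAt-join; join-splitAt)
open import Data.Product using (Σ; ∃; _×_; _,_; proj₁; proj₂)
open import Data.Sum as Sum using (_⊎_; inj₁; inj₂)
open import Function using (_∘_)
open import Relation.Nullary using (Dec; yes; no; contradiction)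
open import Relation.Binary.Definitions using (tri<; tri≈; tri>)
open import Relation.Binary.PropositionalEquality

Between : ℕ → ℕ → ℕ → Set
Between a b c = (a ≤ b × b ≤ c) ⊎ (c ≤ b × b ≤ a)

Between-sym : ∀ {a b c} → Between a b c → Between c b a
Between-sym = Sum.swap

Between-trichotomy : ∀ a b c → Between b a c ⊎ Between a b c ⊎ Between a c b
Between-trichotomy a b c with ≤-total a b | ≤-total b c | ≤-total a c
... | inj₁ a≤b | inj₁ b≤c | _        = inj₂ (inj₁ (inj₁ (a≤b , b≤c)))
... | inj₁ a≤b | inj₂ c≤b | inj₁ a≤c = inj₂ (inj₂ (inj₁ (a≤c , c≤b)))
... | inj₁ a≤b | inj₂ c≤b | inj₂ c≤a = inj₁ (inj₂ (c≤a , a≤b))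
... | inj₂ b≤a | inj₂ c≤b | _        = inj₂ (inj₁ (inj₂ (c≤b , b≤a)))
... | inj₂ b≤a | inj₁ b≤c | inj₁ a≤c = inj₁ (inj₁ (b≤a , a≤c))
... | inj₂ b≤a | inj₁ b≤c | inj₂ c≤a = inj₂ (inj₂ (inj₂ (b≤c , c≤a)))

Between-extend : ∀ {u v w x} → v ≢ w → Between u v w → Between v w x → Between u v x
Between-extend _   (inj₁ (u≤v , v≤w)) (inj₁ (_ , w≤x)) = inj₁ (u≤v , ≤-trans v≤w w≤x)
Between-extend v≢w (inj₁ (_ , v≤w))   (inj₂ (_ , w≤v)) = contradiction (≤-antisym v≤w w≤v) v≢w
Between-extend v≢w (inj₂ (w≤v , _))   (inj₁ (v≤w , _)) = contradiction (≤-antisym v≤w w≤v) v≢w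
Between-extend _   (inj₂ (w≤v , v≤u)) (inj₂ (x≤w , _)) = inj₂ (≤-trans x≤w w≤v , v≤u)

∣-∣-additive-≤ : ∀ {a b c} → a ≤ b → b ≤ c → ∣ a - c ∣ ≡ ∣ a - b ∣ + ∣ b - c ∣
∣-∣-additive-≤ {b = b} z≤n b≤c =
  sym (trans (cong (b +_) (m≤n⇒∣m-n∣≡n∸m b≤c)) (m+[n∸m]≡n b≤c))
∣-∣-additive-≤ (s≤s a≤b) (s≤s b≤c) = ∣-∣-additive-≤ a≤b b≤c

Between⇒∣-∣-additive : ∀ {a b c} → Between a b c → ∣ a - c ∣ ≡ ∣ a - b ∣ + ∣ b - c ∣
Between⇒∣-∣-additive (inj₁ (a≤b , b≤c)) = ∣-∣-additive-≤ a≤b b≤c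
Between⇒∣-∣-additive {a} {b} {c} (inj₂ (c≤b , b≤a)) = begin
  ∣ a - c ∣             ≡⟨ ∣-∣-comm a c ⟩
  ∣ c - a ∣             ≡⟨ ∣-∣-additive-≤ c≤b b≤a ⟩
  ∣ c - b ∣ + ∣ b - a ∣ ≡⟨ +-comm ∣ c - b ∣ ∣ b - a ∣ ⟩
  ∣ b - a ∣ + ∣ c - b ∣ ≡⟨ cong₂ _+_ (∣-∣-comm b a) (∣-∣-comm c b) ⟩
  ∣ a - b ∣ + ∣ b - c ∣ ∎
  where open ≡-Reasoning

∣m-1+m∣≡1 : ∀ m → ∣ m - suc m ∣ ≡ 1
∣m-1+m∣≡1 zero    = refl
∣m-1+m∣≡1 (suc m) = ∣m-1+m∣≡1 m

∣1+m-m∣≡1 : ∀ m → ∣ suc m - m ∣ ≡ 1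
∣1+m-m∣≡1 m = trans (∣-∣-comm (suc m) m) (∣m-1+m∣≡1 m)

∣m-n∣≡1+∣1+m-n∣ : ∀ {m n} → m < n → ∣ m - n ∣ ≡ suc ∣ suc m - n ∣
∣m-n∣≡1+∣1+m-n∣ {zero}  {suc n} _         = refl
∣m-n∣≡1+∣1+m-n∣ {suc m} {suc n} (s≤s m<n) = ∣m-n∣≡1+∣1+m-n∣ m<n

toward : ∀ {i j k} → ∣ i - j ∣ ≡ suc k →
         ∃ λ i′ → ∣ i - i′ ∣ ≡ 1 × ∣ i′ - j ∣ ≡ k × i′ ≤ i ⊔ j
toward {zero}  {suc j} refl = 1 , refl , refl , s≤s z≤n
toward {suc i} {zero}  refl = i , ∣1+m-m∣≡1 i , ∣-∣-identityʳ i , n≤1+n i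
toward {suc i} {suc j} e with toward {i} {j} e
... | i′ , ii′ , i′j , i′≤ = suc i′ , ii′ , i′j , s≤s i′≤

m<n⇒1+m<2*n : ∀ {m n} → m < n → suc m < 2 * n
m<n⇒1+m<2*n {m} {n} m<n = begin-strict
  suc m       ≤⟨ m<n ⟩
  n           <⟨ m<m+n n (≤-trans (≤-trans (s≤s z≤n) m<n) (m≤m+n n 0)) ⟩
  n + (n + 0) ∎
  where open ≤-Reasoning

1+m<2*n⇒0<n : ∀ {m n} → suc m < 2 * n → 0 < n
1+m<2*n⇒0<n {n = suc n} _ = s≤s z≤n

module HeightBounds {V : Set} (d : V → V → ℕ) (h : V → ℕ)
  (d-sym      : ∀ a b → d a b ≡ d b a)
  (d-triangle : ∀ a b c → d a c ≤ d a b + d b c)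
  (∣h-h∣≤2d   : ∀ a b → ∣ h a - h b ∣ ≤ 2 * d a b)
  (2d≤∣h-h∣+2 : ∀ {a b} → h a ≢ h b → 2 * d a b ≤ ∣ h a - h b ∣ + 2)
  (d-level≤2  : ∀ {a b} → h a ≡ h b → d a b ≤ 2)
  (d≡1⇒h≢h    : ∀ {a b} → d a b ≡ 1 → h a ≢ h b)
  where

  private
    Δ : V → V → ℕ
    Δ a b = ∣ h a - h b ∣

    2d≤Δ-before-edge : ∀ {u v w} → d u w ≡ suc (d u v) → h u ≢ h w → 2 * d u v ≤ Δ u w
    2d≤Δ-before-edge {u} {v} {w} uw hu≢hw = +-cancelʳ-≤ 2 (2 * d u v) (Δ u w) (begin
      2 * d u v + 2       ≡⟨ +-comm (2 * d u v) 2 ⟩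
      2 + 2 * d u v       ≡⟨ *-suc 2 (d u v) ⟨
      2 * suc (d u v)     ≡⟨ cong (2 *_) uw ⟨
      2 * d u w           ≤⟨ 2d≤∣h-h∣+2 hu≢hw ⟩
      Δ u w + 2           ∎)
      where open ≤-Reasoning

  edge-on-geodesic : ∀ {u v w} → d v w ≡ 1 → d u w ≡ suc (d u v) →
                     Between (h u) (h v) (h w) ⊎ d u v ≤ 1
  edge-on-geodesic {u} {v} {w} vw uw with h u ≟ h w
  ... | yes hu≡hw = inj₂ (s≤s⁻¹ (subst (_≤ 2) uw (d-level≤2 hu≡hw)))
  ... | no hu≢hw with Between-trichotomy (h u) (h v) (h w)
  ...   | inj₂ (inj₁ v-between) = inj₁ v-between
  ...   | inj₂ (inj₂ w-between) =
    contradiction (∣m-n∣≡0⇒m≡n (n≤0⇒n≡0 Δwv≤0)) (d≡1⇒h≢h (trans (d-sym w v) vw))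
    where
    Δwv≤0 : Δ w v ≤ 0
    Δwv≤0 = +-cancelˡ-≤ (Δ u w) (Δ w v) 0 (begin
      Δ u w + Δ w v ≡⟨ Between⇒∣-∣-additive w-between ⟨
      Δ u v         ≤⟨ ∣h-h∣≤2d u v ⟩
      2 * d u v     ≤⟨ 2d≤Δ-before-edge uw hu≢hw ⟩
      Δ u w         ≡⟨ +-identityʳ (Δ u w) ⟨
      Δ u w + 0     ∎)
      where open ≤-Reasoning
  ...   | inj₁ u-between = inj₂ (*-cancelˡ-≤ 2 (begin
      2 * d u v     ≤⟨ 2d≤Δ-before-edge uw hu≢hw ⟩
      Δ u w         ≤⟨ m≤n+m (Δ u w) (Δ v u) ⟩
      Δ v u + Δ u w ≡⟨ Between⇒∣-∣-additive u-between ⟨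
      Δ v w         ≤⟨ ∣h-h∣≤2d v w ⟩
      2 * d v w     ≡⟨ cong (2 *_) vw ⟩
      2 * 1         ∎))
      where open ≤-Reasoning

  private
    near-start : ∀ {u v x} → d u v ≤ 1 → d u v + d v x ≤ d u x + 2
    near-start {u} {v} {x} uv≤1 = begin
      d u v + d v x           ≤⟨ +-monoʳ-≤ (d u v) (d-triangle v u x) ⟩
      d u v + (d v u + d u x) ≡⟨ cong (λ t → d u v + (t + d u x)) (d-sym v u) ⟩
      d u v + (d u v + d u x) ≡⟨ +-assoc (d u v) (d u v) (d u x) ⟨
      d u v + d u v + d u x   ≤⟨ +-monoˡ-≤ (d u x) (+-mono-≤ uv≤1 uv≤1) ⟩
      2 + d u x               ≡⟨ +-comm 2 (d u x) ⟩
      d u x + 2               ∎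
      where open ≤-Reasoning

    reversed : ∀ {u v w x} → d u w ≡ suc (d u v) → d v x ≡ suc (d w x) → d u v + d v x ≡ d x w + d w u
    reversed {u} {v} {w} {x} uw vx = begin
      d u v + d v x       ≡⟨ cong (d u v +_) vx ⟩
      d u v + suc (d w x) ≡⟨ +-suc (d u v) (d w x) ⟩
      suc (d u v) + d w x ≡⟨ cong (_+ d w x) uw ⟨
      d u w + d w x       ≡⟨ +-comm (d u w) (d w x) ⟩
      d w x + d u w       ≡⟨ cong₂ _+_ (d-sym w x) (d-sym u w) ⟩
      d x w + d w u       ∎
      where open ≡-Reasoning

    monotone : ∀ {u v w x} → d v w ≡ 1 → d u w ≡ suc (d u v) →
               Between (h u) (h v) (h w) → Between (h v) (h w) (h x) → d u v + d v x ≤ d u x + 2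
    monotone {u} {v} {w} {x} vw uw uvw vwx = *-cancelˡ-≤ 2 (begin
      2 * (d u v + d v x)             ≡⟨ *-distribˡ-+ 2 (d u v) (d v x) ⟩
      2 * d u v + 2 * d v x           ≤⟨ +-mono-≤ 2duv≤ 2dvx≤ ⟩
      (Δ u v + Δ v w) + (Δ v w + Δ w x + 2) ≡⟨ regroup (Δ u v) (Δ v w) (Δ w x) ⟩
      (Δ u v + (Δ v w + Δ w x)) + (Δ v w + 2) ≤⟨ +-mono-≤ Δux≤ (+-monoˡ-≤ 2 Δvw≤2) ⟩
      2 * d u x + 4                   ≡⟨ *-distribˡ-+ 2 (d u x) 2 ⟨
      2 * (d u x + 2)                 ∎)
      where
      open ≤-Reasoning
      regroup : ∀ a b c → (a + b) + (b + c + 2) ≡ (a + (b + c)) + (b + 2)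
      regroup = solve-∀
      hv≢hw : h v ≢ h w
      hv≢hw = d≡1⇒h≢h vw
      Δuw≡ : Δ u w ≡ Δ u v + Δ v w
      Δuw≡ = Between⇒∣-∣-additive uvw
      Δvx≡ : Δ v x ≡ Δ v w + Δ w x
      Δvx≡ = Between⇒∣-∣-additive vwx
      Δux≡ : Δ u x ≡ Δ u v + Δ v x
      Δux≡ = Between⇒∣-∣-additive (Between-extend hv≢hw uvw vwx)
      apart : ∀ {a b} → Δ v w ≤ Δ a b → h a ≢ h b
      apart Δvw≤Δab ha≡hb =
        hv≢hw (∣m-n∣≡0⇒m≡n (n≤0⇒n≡0 (subst (Δ v w ≤_) (m≡n⇒∣m-n∣≡0 ha≡hb) Δvw≤Δab)))
      2duv≤ : 2 * d u v ≤ Δ u v + Δ v w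
      2duv≤ = subst (2 * d u v ≤_) Δuw≡
                (2d≤Δ-before-edge uw (apart (subst (Δ v w ≤_) (sym Δuw≡) (m≤n+m (Δ v w) (Δ u v)))))
      2dvx≤ : 2 * d v x ≤ Δ v w + Δ w x + 2
      2dvx≤ = subst (λ t → 2 * d v x ≤ t + 2) Δvx≡
                (2d≤∣h-h∣+2 (apart (subst (Δ v w ≤_) (sym Δvx≡) (m≤m+n (Δ v w) (Δ w x)))))
      Δvw≤2 : Δ v w ≤ 2
      Δvw≤2 = subst (λ t → Δ v w ≤ 2 * t) vw (∣h-h∣≤2d v w)
      Δux≤ : Δ u v + (Δ v w + Δ w x) ≤ 2 * d u x
      Δux≤ = subst (_≤ 2 * d u x) (trans Δux≡ (cong (Δ u v +_) Δvx≡)) (∣h-h∣≤2d u x)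

  α₂ : ∀ {u v w x} → d v w ≡ 1 → d u w ≡ suc (d u v) → d v x ≡ suc (d w x) →
       d u v + d v x ≤ d u x + 2
  α₂ {u} {v} {w} {x} vw uw vx
    with edge-on-geodesic vw uw
       | edge-on-geodesic (trans (d-sym w v) vw) (trans (d-sym x v) (trans vx (cong suc (d-sym w x))))
  ... | inj₂ uv≤1 | _ = near-start uv≤1
  ... | inj₁ _ | inj₂ xw≤1 = begin
    d u v + d v x ≡⟨ reversed uw vx ⟩
    d x w + d w u ≤⟨ near-start xw≤1 ⟩
    d x u + 2     ≡⟨ cong (_+ 2) (d-sym x u) ⟩
    d u x + 2     ∎
    where open ≤-Reasoning
  ... | inj₁ uvw | inj₁ xwv = monotone vw uw uvw (Between-sym xwv)

record GraphMetric (n : ℕ) : Set where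
  field
    d           : Fin n → Fin n → ℕ
    d-sym       : ∀ a b → d a b ≡ d b a
    d-refl      : ∀ a → d a a ≡ 0
    d≡0⇒≡       : ∀ {a b} → d a b ≡ 0 → a ≡ b
    d-lipschitz : ∀ {a c} b → d a c ≡ 1 → d a b ≤ suc (d c b)
    d-geodesic  : ∀ {a b k} → d a b ≡ 2 + k → ∃ λ c → d a c ≡ 1 × d c b ≡ suc k

  graph : Graph n
  graph = record
    { Adj    = λ a b → d a b ≡ 1
    ; adj?   = λ a b → d a b ≟ 1
    ; sym    = λ {a} {b} ab → trans (d-sym b a) ab
    ; irrefl = λ {a} aa → 0≢1+n (trans (sym (d-refl a)) aa)
    }

  walk-lipschitz : ∀ {a b m} c → Walk graph a b m → d a c ≤ m + d b c
  walk-lipschitz c []       = ≤-refl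
  walk-lipschitz c (ab ∷ w) = ≤-trans (d-lipschitz c ab) (s≤s (walk-lipschitz c w))

  geodesic : ∀ {a b} k → d a b ≡ k → Walk graph a b k
  geodesic {a} zero          ab = subst (λ b → Walk graph a b 0) (d≡0⇒≡ ab) []
  geodesic     (suc zero)    ab = ab ∷ []
  geodesic     (suc (suc k)) ab = let _ , ac , cb = d-geodesic ab in ac ∷ geodesic (suc k) cb

  d-triangle : ∀ a b c → d a c ≤ d a b + d b c
  d-triangle a b c = walk-lipschitz c (geodesic (d a b) refl)

  d-is-Dist : ∀ a b → Dist graph a b (d a b)
  d-is-Dist a b = geodesic (d a b) refl , shortest
    where
    shortest : ∀ m → Walk graph a b m → d a b ≤ m
    shortest m w = subst (d a b ≤_) (trans (cong (m +_) (d-refl b)) (+-identityʳ m)) (walk-lipschitz b w)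

  Dist⇒≡d : ∀ {a b k} → Dist graph a b k → k ≡ d a b
  Dist⇒≡d {a} {b} (w , shortest) =
    ≤-antisym (shortest (d a b) (geodesic (d a b) refl)) (proj₂ (d-is-Dist a b) _ w)

  connected : Connected graph
  connected a b = d a b , geodesic (d a b) refl

  InI⇒d+d≡d : ∀ {u v z} → InI graph u v z → d u z + d z v ≡ d u v
  InI⇒d+d≡d (_ , _ , _ , uv , uz , zv , a≡b+c) =
    trans (cong₂ _+_ (sym (Dist⇒≡d uz)) (sym (Dist⇒≡d zv))) (trans (sym a≡b+c) (Dist⇒≡d uv))

  alpha2Metric : (∀ {u v w x} → d v w ≡ 1 → d u w ≡ suc (d u v) → d v x ≡ suc (d w x) →
                  d u v + d v x ≤ d u x + 2) →
                 Alpha2Metric graph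
  alpha2Metric α₂ u v w x v∈I[u,w] w∈I[v,x] vw _ _ _ ux uv vx
    with Dist⇒≡d ux | Dist⇒≡d uv | Dist⇒≡d vx
  ... | refl | refl | refl = α₂ vw uw (trans (sym (InI⇒d+d≡d w∈I[v,x])) (cong (_+ d w x) vw))
    where
    uw : d u w ≡ suc (d u v)
    uw = trans (sym (InI⇒d+d≡d v∈I[u,w])) (trans (cong (d u v +_) vw) (+-comm (d u v) 1))

  InIo-sym : ∀ {u v z} → InIo graph u v z → InIo graph v u z
  InIo-sym {u} {v} {z} (z∈I , z≢u , z≢v) =
    (d v u , d v z , d z u , d-is-Dist v u , d-is-Dist v z , d-is-Dist z u , vu≡vz+zu) , z≢v , z≢u
    where
    vu≡vz+zu : d v u ≡ d v z + d z u
    vu≡vz+zu = begin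
      d v u         ≡⟨ d-sym v u ⟩
      d u v         ≡⟨ InI⇒d+d≡d z∈I ⟨
      d u z + d z v ≡⟨ +-comm (d u z) (d z v) ⟩
      d z v + d u z ≡⟨ cong₂ _+_ (d-sym z v) (d-sym u z) ⟩
      d v z + d z u ∎
      where open ≡-Reasoning

  InIo-at-distance-2 : ∀ {u v z} → d u v ≡ 2 → InIo graph u v z → d u z ≡ 1 × d z v ≡ 1
  InIo-at-distance-2 {u} {v} {z} uv (z∈I , z≢u , z≢v) =
    both-one (d u z) (d z v) (trans (InI⇒d+d≡d z∈I) uv) (z≢u ∘ sym ∘ d≡0⇒≡) (z≢v ∘ d≡0⇒≡)
    where
    both-one : ∀ m n → m + n ≡ 2 → m ≢ 0 → n ≢ 0 → m ≡ 1 × n ≡ 1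
    both-one zero          _             _  m≢0 _   = contradiction refl m≢0
    both-one (suc _)       zero          _  _   n≢0 = contradiction refl n≢0
    both-one (suc zero)    (suc zero)    _  _   _   = refl , refl
    both-one (suc zero)    (suc (suc _)) ()
    both-one (suc (suc m)) (suc n)       e  =
      contradiction (trans (sym (+-suc m n)) (suc-injective (suc-injective e))) λ ()

data Side : Set where
  Y Z : Side

_≟ˢ_ : (s t : Side) → Dec (s ≡ t)
Y ≟ˢ Y = yes refl
Z ≟ˢ Z = yes refl
Y ≟ˢ Z = no λ ()
Z ≟ˢ Y = no λ ()

data Point : Set where
  apex : Point
  side : Side → ℕ → Point
  mid  : ℕ → Point

height : Point → ℕ
height apex       = 0
height (side _ i) = 2 * suc i
height (mid l)    = suc (2 * suc l)

-- y_i and z_j are joined only through the apex or the middle path.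
sideToSide : Side → Side → ℕ → ℕ
sideToSide Y Y n = n
sideToSide Z Z n = n
sideToSide _ _ n = suc (n ⊔ 1)

-- sideToMid i l = ⌈ |(2i + 2) - (2l + 3)| / 2 ⌉ is the distance from side s i to mid l.
sideToMid : ℕ → ℕ → ℕ
sideToMid zero    l       = suc l
sideToMid (suc i) zero    = suc i
sideToMid (suc i) (suc l) = sideToMid i l

dist : Point → Point → ℕ
dist apex       apex       = 0
dist apex       (side _ j) = suc j
dist apex       (mid l)    = 2 + l
dist (side _ i) apex       = suc i
dist (side s i) (side t j) = sideToSide s t ∣ i - j ∣
dist (side _ i) (mid l)    = sideToMid i l
dist (mid k)    apex       = 2 + k
dist (mid k)    (side _ j) = sideToMid j k
dist (mid k)    (mid l)    = ∣ k - l ∣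

dist-same-side : ∀ s i j → dist (side s i) (side s j) ≡ ∣ i - j ∣
dist-same-side Y i j = refl
dist-same-side Z i j = refl

dist-opposite-sides : ∀ {s t} → s ≢ t → ∀ i j → dist (side s i) (side t j) ≡ suc (∣ i - j ∣ ⊔ 1)
dist-opposite-sides {Y} {Y} Y≢Y = contradiction refl Y≢Y
dist-opposite-sides {Y} {Z} _   i j = refl
dist-opposite-sides {Z} {Y} _   i j = refl
dist-opposite-sides {Z} {Z} Z≢Z = contradiction refl Z≢Z

opposite-sides-far : ∀ {s t} → s ≢ t → ∀ i j → 2 ≤ dist (side s i) (side t j)
opposite-sides-far s≢t i j =
  subst (2 ≤_) (sym (dist-opposite-sides s≢t i j)) (s≤s (m≤n⊔m ∣ i - j ∣ 1))

sideToSide-sym : ∀ s t n → sideToSide s t n ≡ sideToSide t s n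
sideToSide-sym Y Y n = refl
sideToSide-sym Y Z n = refl
sideToSide-sym Z Y n = refl
sideToSide-sym Z Z n = refl

dist-sym : ∀ a b → dist a b ≡ dist b a
dist-sym apex       apex       = refl
dist-sym apex       (side _ _) = refl
dist-sym apex       (mid _)    = refl
dist-sym (side _ _) apex       = refl
dist-sym (side s i) (side t j) = trans (cong (sideToSide s t) (∣-∣-comm i j)) (sideToSide-sym s t ∣ j - i ∣)
dist-sym (side _ _) (mid _)    = refl
dist-sym (mid _)    apex       = refl
dist-sym (mid _)    (side _ _) = refl
dist-sym (mid k)    (mid l)    = ∣-∣-comm k l

dist-refl : ∀ a → dist a a ≡ 0
dist-refl apex       = refl
dist-refl (side s i) = trans (dist-same-side s i i) (∣n-n∣≡0 i)
dist-refl (mid l)    = ∣n-n∣≡0 l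

sideToMid≢0 : ∀ i l → sideToMid i l ≢ 0
sideToMid≢0 zero    l       ()
sideToMid≢0 (suc i) zero    ()
sideToMid≢0 (suc i) (suc l) = sideToMid≢0 i l

dist≡0⇒≡ : ∀ {a b} → dist a b ≡ 0 → a ≡ b
dist≡0⇒≡ {apex}     {apex}     _ = refl
dist≡0⇒≡ {side Y i} {side Y j} e = cong (side Y) (∣m-n∣≡0⇒m≡n e)
dist≡0⇒≡ {side Z i} {side Z j} e = cong (side Z) (∣m-n∣≡0⇒m≡n e)
dist≡0⇒≡ {side _ i} {mid l}    e = contradiction e (sideToMid≢0 i l)
dist≡0⇒≡ {mid k}    {side _ j} e = contradiction e (sideToMid≢0 j k)
dist≡0⇒≡ {mid k}    {mid l}    e = cong mid (∣m-n∣≡0⇒m≡n e)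

sideToMid-≤ : ∀ {i l} → i ≤ l → sideToMid i l ≡ suc ∣ i - l ∣
sideToMid-≤ z≤n       = refl
sideToMid-≤ (s≤s i≤l) = sideToMid-≤ i≤l

sideToMid-> : ∀ {i l} → l < i → sideToMid i l ≡ ∣ i - l ∣
sideToMid-> {suc i} {zero}  _         = refl
sideToMid-> {suc i} {suc l} (s≤s l<i) = sideToMid-> l<i

sideToMid-l-l : ∀ l → sideToMid l l ≡ 1
sideToMid-l-l zero    = refl
sideToMid-l-l (suc l) = sideToMid-l-l l

sideToMid-1+l-l : ∀ l → sideToMid (suc l) l ≡ 1
sideToMid-1+l-l zero    = refl
sideToMid-1+l-l (suc l) = sideToMid-1+l-l l

sideToMid≡1 : ∀ {i l} → sideToMid i l ≡ 1 → i ≡ l ⊎ i ≡ suc l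
sideToMid≡1 {zero}     {zero}  _ = inj₁ refl
sideToMid≡1 {suc zero} {zero}  _ = inj₂ refl
sideToMid≡1 {suc i}    {suc l} e = Sum.map (cong suc) (cong suc) (sideToMid≡1 e)

∣i-l∣≤sideToMid : ∀ i l → ∣ i - l ∣ ≤ sideToMid i l
∣i-l∣≤sideToMid zero    l       = n≤1+n l
∣i-l∣≤sideToMid (suc i) zero    = ≤-refl
∣i-l∣≤sideToMid (suc i) (suc l) = ∣i-l∣≤sideToMid i l

∣i-1+l∣≤sideToMid : ∀ i l → ∣ i - suc l ∣ ≤ sideToMid i l
∣i-1+l∣≤sideToMid zero    l       = ≤-refl
∣i-1+l∣≤sideToMid (suc i) zero    = ≤-trans (≤-reflexive (∣-∣-identityʳ i)) (n≤1+n i)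
∣i-1+l∣≤sideToMid (suc i) (suc l) = ∣i-1+l∣≤sideToMid i l

sideToMid-toward : ∀ {i l k} → sideToMid i l ≡ 2 + k →
                   ∃ λ m → sideToMid i m ≡ 1 × ∣ m - l ∣ ≡ suc k × m ≤ i ⊔ l
sideToMid-toward {zero}  {suc k} refl = 0 , refl , refl , z≤n
sideToMid-toward {suc i} {zero}  refl = i , sideToMid-1+l-l i , ∣-∣-identityʳ i , n≤1+n i
sideToMid-toward {suc i} {suc l} e with sideToMid-toward {i} {l} e
... | m , im , ml , m≤ = suc m , im , ml , s≤s m≤

sideToMid-between : ∀ i j → ∃ λ m → sideToMid i m ≡ 1 × sideToMid j m ≡ ∣ i - j ∣ ⊔ 1 × m ≤ i
sideToMid-between zero    zero    = 0 , refl , refl , z≤n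
sideToMid-between zero    (suc j) = 0 , refl , cong suc (sym (⊔-identityʳ j)) , z≤n
sideToMid-between (suc i) zero    = i , sideToMid-1+l-l i , cong suc (sym (⊔-identityʳ i)) , n≤1+n i
sideToMid-between (suc i) (suc j) with sideToMid-between i j
... | m , im , jm , m≤i = suc m , im , jm , s≤s m≤i

2*sideToMid : ∀ i l → 2 * sideToMid i l ≡ ∣ 2 * suc i - suc (2 * suc l) ∣ + 1
2*sideToMid i l with ≤-<-connex i l
... | inj₁ i≤l = begin
  2 * sideToMid i l              ≡⟨ cong (2 *_) (sideToMid-≤ i≤l) ⟩
  2 * suc ∣ i - l ∣              ≡⟨ *-suc 2 ∣ i - l ∣ ⟩
  2 + 2 * ∣ i - l ∣              ≡⟨ +-comm 2 (2 * ∣ i - l ∣) ⟩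
  2 * ∣ i - l ∣ + 2              ≡⟨ cong (_+ 2) (*-distribˡ-∣-∣ 2 (suc i) (suc l)) ⟩
  ∣ hi - hl ∣ + 2                ≡⟨ +-assoc ∣ hi - hl ∣ 1 1 ⟨
  ∣ hi - hl ∣ + 1 + 1            ≡⟨ cong (λ t → ∣ hi - hl ∣ + t + 1) (∣m-1+m∣≡1 hl) ⟨
  ∣ hi - hl ∣ + ∣ hl - suc hl ∣ + 1 ≡⟨ cong (_+ 1) (Between⇒∣-∣-additive (inj₁ (hi≤hl , n≤1+n hl))) ⟨
  ∣ hi - suc hl ∣ + 1            ∎
  where
  open ≡-Reasoning
  hi = 2 * suc i
  hl = 2 * suc l
  hi≤hl : hi ≤ hl
  hi≤hl = *-monoʳ-≤ 2 (s≤s i≤l)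
... | inj₂ l<i = begin
  2 * sideToMid i l              ≡⟨ cong (2 *_) (sideToMid-> l<i) ⟩
  2 * ∣ i - l ∣                  ≡⟨ cong (2 *_) (∣-∣-comm i l) ⟩
  2 * ∣ l - i ∣                  ≡⟨ *-distribˡ-∣-∣ 2 (suc l) (suc i) ⟩
  ∣ hl - hi ∣                    ≡⟨ Between⇒∣-∣-additive (inj₁ (n≤1+n hl , 1+hl≤hi)) ⟩
  ∣ hl - suc hl ∣ + ∣ suc hl - hi ∣ ≡⟨ cong₂ _+_ (∣m-1+m∣≡1 hl) (∣-∣-comm (suc hl) hi) ⟩
  1 + ∣ hi - suc hl ∣            ≡⟨ +-comm 1 ∣ hi - suc hl ∣ ⟩
  ∣ hi - suc hl ∣ + 1            ∎
  where
  open ≡-Reasoning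
  hi = 2 * suc i
  hl = 2 * suc l
  1+hl≤hi : suc hl ≤ hi
  1+hl≤hi = *-monoʳ-< 2 (s≤s l<i)

data DistView : Point → Point → Set where
  opposite-sides : ∀ {s t} → s ≢ t → ∀ i j → DistView (side s i) (side t j)
  by-height      : ∀ {a b} e → e ≤ 1 → 2 * dist a b ≡ ∣ height a - height b ∣ + e → DistView a b

DistView-sym : ∀ {a b} → DistView a b → DistView b a
DistView-sym (opposite-sides s≢t i j) = opposite-sides (s≢t ∘ sym) j i
DistView-sym {a} {b} (by-height e e≤1 eq) = by-height e e≤1
  (trans (cong (2 *_) (dist-sym b a)) (trans eq (cong (_+ e) (∣-∣-comm (height a) (height b)))))

distView : ∀ a b → DistView a b
distView apex       apex       = by-height 0 z≤n refl
distView apex       (side _ j) = by-height 0 z≤n (sym (+-identityʳ (2 * suc j)))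
distView apex       (mid l)    = by-height 1 ≤-refl (apex-to-mid l)
  where
  apex-to-mid : ∀ l → 2 * (2 + l) ≡ suc (2 * suc l) + 1
  apex-to-mid = solve-∀
distView (side s i) (side t j) with s ≟ˢ t
... | yes refl = by-height 0 z≤n (begin
  2 * dist (side s i) (side s j)   ≡⟨ cong (2 *_) (dist-same-side s i j) ⟩
  2 * ∣ suc i - suc j ∣            ≡⟨ *-distribˡ-∣-∣ 2 (suc i) (suc j) ⟩
  ∣ 2 * suc i - 2 * suc j ∣        ≡⟨ +-identityʳ _ ⟨
  ∣ 2 * suc i - 2 * suc j ∣ + 0    ∎)
  where open ≡-Reasoning
... | no s≢t   = opposite-sides s≢t i j
distView (side _ i) (mid l)    = by-height 1 ≤-refl (2*sideToMid i l)
distView (mid k)    (mid l)    = by-height 0 z≤n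
  (trans (*-distribˡ-∣-∣ 2 (suc k) (suc l)) (sym (+-identityʳ _)))
distView a@(side _ _) b@apex     = DistView-sym (distView b a)
distView a@(mid _)    b@apex     = DistView-sym (distView b a)
distView a@(mid _)    b@(side _ _) = DistView-sym (distView b a)

∣height-height∣≤2*dist : ∀ a b → ∣ height a - height b ∣ ≤ 2 * dist a b
∣height-height∣≤2*dist a b with distView a b
... | by-height e _ eq = subst (∣ height a - height b ∣ ≤_) (sym eq) (m≤m+n _ e)
... | opposite-sides {s} {t} s≢t i j = begin
  ∣ 2 * suc i - 2 * suc j ∣ ≡⟨ *-distribˡ-∣-∣ 2 (suc i) (suc j) ⟨
  2 * ∣ i - j ∣            ≤⟨ *-monoʳ-≤ 2 (≤-trans (m≤m⊔n ∣ i - j ∣ 1) (n≤1+n _)) ⟩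
  2 * suc (∣ i - j ∣ ⊔ 1)  ≡⟨ cong (2 *_) (dist-opposite-sides s≢t i j) ⟨
  2 * dist (side s i) (side t j) ∎
  where open ≤-Reasoning

2*dist≤∣height-height∣+2 : ∀ {a b} → height a ≢ height b →
                           2 * dist a b ≤ ∣ height a - height b ∣ + 2
2*dist≤∣height-height∣+2 {a} {b} ha≢hb with distView a b
... | by-height e e≤1 eq =
  subst (_≤ ∣ height a - height b ∣ + 2) (sym eq) (+-monoʳ-≤ ∣ height a - height b ∣ (m≤n⇒m≤1+n e≤1))
... | opposite-sides {s} {t} s≢t i j = begin
  2 * dist (side s i) (side t j) ≡⟨ cong (2 *_) (dist-opposite-sides s≢t i j) ⟩
  2 * suc (∣ i - j ∣ ⊔ 1)        ≡⟨ cong (λ t → 2 * suc t) (m≥n⇒m⊔n≡m 1≤∣i-j∣) ⟩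
  2 * suc ∣ i - j ∣              ≡⟨ *-suc 2 ∣ i - j ∣ ⟩
  2 + 2 * ∣ i - j ∣              ≡⟨ +-comm 2 _ ⟩
  2 * ∣ i - j ∣ + 2              ≡⟨ cong (_+ 2) (*-distribˡ-∣-∣ 2 (suc i) (suc j)) ⟩
  ∣ 2 * suc i - 2 * suc j ∣ + 2  ∎
  where
  open ≤-Reasoning
  1≤∣i-j∣ : 1 ≤ ∣ i - j ∣
  1≤∣i-j∣ = n≢0⇒n>0 λ ∣i-j∣≡0 → ha≢hb (cong (λ k → 2 * suc k) (∣m-n∣≡0⇒m≡n ∣i-j∣≡0))

dist-level≤2 : ∀ {a b} → height a ≡ height b → dist a b ≤ 2
dist-level≤2 {a} {b} ha≡hb with distView a b
... | by-height e e≤1 eq = ≤-trans (m≤m+n (dist a b) _) (≤-trans 2d≤1 (n≤1+n 1))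
  where
  2d≤1 : 2 * dist a b ≤ 1
  2d≤1 = subst (_≤ 1) (sym (trans eq (cong (_+ e) (m≡n⇒∣m-n∣≡0 ha≡hb)))) e≤1
... | opposite-sides {s} {t} s≢t i j = ≤-reflexive (begin
  dist (side s i) (side t j) ≡⟨ dist-opposite-sides s≢t i j ⟩
  suc (∣ i - j ∣ ⊔ 1)        ≡⟨ cong (λ t → suc (t ⊔ 1)) (m≡n⇒∣m-n∣≡0 i≡j) ⟩
  2                          ∎)
  where
  open ≡-Reasoning
  i≡j : i ≡ j
  i≡j = suc-injective (*-cancelˡ-≡ (suc i) (suc j) 2 ha≡hb)

dist≡1⇒height≢height : ∀ {a b} → dist a b ≡ 1 → height a ≢ height b
dist≡1⇒height≢height {a} {b} d≡1 ha≡hb with distView a b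
... | opposite-sides {s} {t} s≢t i j = contradiction d≡1 (>⇒≢ (opposite-sides-far s≢t i j))
... | by-height e e≤1 eq =
  contradiction (subst (_≤ 1) (trans (sym eq') (cong (2 *_) d≡1)) e≤1) (λ { (s≤s ()) })
  where
  eq' : 2 * dist a b ≡ e
  eq' = trans eq (cong (_+ e) (m≡n⇒∣m-n∣≡0 ha≡hb))

opposite-sides-lipschitz : ∀ {s t} → s ≢ t → ∀ {i j} c → dist (side s i) c ≡ 1 →
                           dist (side s i) (side t j) ≤ suc (dist c (side t j))
opposite-sides-lipschitz {s} {t} s≢t {zero} {j} apex _ = begin
  dist (side s 0) (side t j) ≡⟨ dist-opposite-sides s≢t 0 j ⟩
  suc (j ⊔ 1)                ≤⟨ s≤s (⊔-lub (n≤1+n j) (s≤s z≤n)) ⟩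
  suc (suc j)                ∎
  where open ≤-Reasoning
opposite-sides-lipschitz {s} {t} s≢t {i} {j} (side u k) ac with u ≟ˢ s
... | no u≢s  = contradiction ac (>⇒≢ (opposite-sides-far (u≢s ∘ sym) i k))
... | yes refl = begin
  dist (side s i) (side t j)     ≡⟨ dist-opposite-sides s≢t i j ⟩
  suc (∣ i - j ∣ ⊔ 1)            ≤⟨ s≤s (⊔-lub ∣i-j∣≤ (s≤s z≤n)) ⟩
  suc (suc (∣ k - j ∣ ⊔ 1))      ≡⟨ cong suc (dist-opposite-sides s≢t k j) ⟨
  suc (dist (side s k) (side t j)) ∎
  where
  open ≤-Reasoning
  ∣i-j∣≤ : ∣ i - j ∣ ≤ suc (∣ k - j ∣ ⊔ 1)
  ∣i-j∣≤ = begin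
    ∣ i - j ∣             ≤⟨ ∣-∣-triangle i k j ⟩
    ∣ i - k ∣ + ∣ k - j ∣ ≡⟨ cong (_+ ∣ k - j ∣) (trans (sym (dist-same-side s i k)) ac) ⟩
    suc ∣ k - j ∣         ≤⟨ s≤s (m≤m⊔n ∣ k - j ∣ 1) ⟩
    suc (∣ k - j ∣ ⊔ 1)   ∎
opposite-sides-lipschitz {s} {t} s≢t {i} {j} (mid l) ac = begin
  dist (side s i) (side t j) ≡⟨ dist-opposite-sides s≢t i j ⟩
  suc (∣ i - j ∣ ⊔ 1)        ≤⟨ s≤s (⊔-lub ∣i-j∣≤ (n≢0⇒n>0 (sideToMid≢0 j l))) ⟩
  suc (sideToMid j l)        ∎
  where
  open ≤-Reasoning
  ∣i-j∣≤ : ∣ i - j ∣ ≤ sideToMid j l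
  ∣i-j∣≤ with sideToMid≡1 {i} {l} ac
  ... | inj₁ refl = subst (_≤ sideToMid j l) (∣-∣-comm j i) (∣i-l∣≤sideToMid j l)
  ... | inj₂ refl = subst (_≤ sideToMid j l) (∣-∣-comm j i) (∣i-1+l∣≤sideToMid j l)

dist-lipschitz : ∀ {a c} b → dist a c ≡ 1 → dist a b ≤ suc (dist c b)
dist-lipschitz {a} {c} b ac with distView a b
... | opposite-sides s≢t i j = opposite-sides-lipschitz s≢t c ac
... | by-height e e≤1 eq = s≤s⁻¹ (*-cancelˡ-< 2 (dist a b) (suc (suc (dist c b))) (begin-strict
  2 * dist a b                  ≡⟨ eq ⟩
  ∣ ha - hb ∣ + e               ≤⟨ +-mono-≤ (∣-∣-triangle ha hc hb) e≤1 ⟩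
  ∣ ha - hc ∣ + ∣ hc - hb ∣ + 1 ≤⟨ +-monoˡ-≤ 1 (+-mono-≤ ∣ha-hc∣≤2 (∣height-height∣≤2*dist c b)) ⟩
  2 + 2 * dist c b + 1          <⟨ n<1+n _ ⟩
  3 + 2 * dist c b + 1          ≡⟨ regroup (dist c b) ⟩
  2 * suc (suc (dist c b))      ∎))
  where
  open ≤-Reasoning
  ha = height a
  hb = height b
  hc = height c
  ∣ha-hc∣≤2 : ∣ ha - hc ∣ ≤ 2
  ∣ha-hc∣≤2 = subst (λ k → ∣ ha - hc ∣ ≤ 2 * k) ac (∣height-height∣≤2*dist a c)
  regroup : ∀ n → 3 + 2 * n + 1 ≡ 2 * suc (suc n)
  regroup = solve-∀

-- The middle path runs on past the top of the sides, up to mid (2p - 2), only to make the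
-- number of vertices exactly 4p.
Valid : ℕ → Point → Set
Valid p apex       = 0 < 2 * p
Valid p (side _ i) = i < p
Valid p (mid l)    = suc l < 2 * p

GeodesicStep : ℕ → Point → Point → Set
GeodesicStep p a b = ∀ {k} → dist a b ≡ 2 + k → ∃ λ c → Valid p c × dist a c ≡ 1 × dist c b ≡ suc k

geodesic-step-apex : ∀ {p b} → Valid p b → GeodesicStep p apex b
geodesic-step-apex {b = side s (suc k)} vb refl =
  side s 0 , ≤-trans (s≤s z≤n) vb , refl , dist-same-side s 0 (suc k)
geodesic-step-apex {b = mid l} vb refl = side Y 0 , 1+m<2*n⇒0<n vb , refl , refl

geodesic-step-side : ∀ {p s i b} → i < p → Valid p b → GeodesicStep p (side s i) b
geodesic-step-side {s = s} {suc k} {apex} vi _ refl =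
  side s k , ≤-trans (n≤1+n _) vi , trans (dist-same-side s (suc k) k) (∣1+m-m∣≡1 k) , refl
geodesic-step-side {s = s} {i} {side t j} vi vj e with s ≟ˢ t
... | yes refl with toward (trans (sym (dist-same-side s i j)) e)
...   | i′ , ii′ , i′j , i′≤ = side s i′ , ≤-<-trans i′≤ (⊔-lub vi vj) ,
          trans (dist-same-side s i i′) ii′ , trans (dist-same-side s i′ j) i′j
geodesic-step-side {s = s} {i} {side t j} vi vj e | no s≢t with sideToMid-between i j
... | m , im , jm , m≤i = mid m , ≤-<-trans (s≤s m≤i) (m<n⇒1+m<2*n vi) , im ,
        trans jm (suc-injective (trans (sym (dist-opposite-sides s≢t i j)) e))
geodesic-step-side {i = i} {mid l} vi vl e with sideToMid-toward {i} {l} e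
... | m , im , ml , m≤ = mid m , ≤-trans (s≤s (s≤s m≤)) (⊔-lub (m<n⇒1+m<2*n vi) vl) , im , ml

geodesic-step-mid : ∀ {p l b} → suc l < 2 * p → Valid p b → GeodesicStep p (mid l) b
geodesic-step-mid {l = zero}  {apex} vl _ refl = side Y 0 , 1+m<2*n⇒0<n vl , refl , refl
geodesic-step-mid {l = suc l} {apex} vl _ refl = mid l , ≤-trans (n≤1+n _) vl , ∣1+m-m∣≡1 l , refl
geodesic-step-mid {l = l} {side s j} vl vj e with <-cmp j l
... | tri> _ _ l<j = side s (suc l) , ≤-<-trans l<j vj , sideToMid-1+l-l l ,
        trans (dist-same-side s (suc l) j) (suc-injective (begin
          suc ∣ suc l - j ∣ ≡⟨ ∣m-n∣≡1+∣1+m-n∣ l<j ⟨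
          ∣ l - j ∣         ≡⟨ ∣-∣-comm l j ⟩
          ∣ j - l ∣         ≡⟨ sideToMid-> l<j ⟨
          sideToMid j l     ≡⟨ e ⟩
          2 + _             ∎))
  where open ≡-Reasoning
... | tri≈ _ refl _ = contradiction (trans (sym (sideToMid-l-l j)) e) λ ()
geodesic-step-mid {l = suc l} {side s j} vl vj e | tri< (s≤s j≤l) _ _ =
  mid l , ≤-trans (n≤1+n _) vl , ∣1+m-m∣≡1 l , suc-injective (begin
    suc (sideToMid j l) ≡⟨ cong suc (sideToMid-≤ j≤l) ⟩
    suc (suc ∣ j - l ∣) ≡⟨ cong suc (∣m-n∣≡1+∣1+m-n∣ (s≤s j≤l)) ⟨
    suc ∣ j - suc l ∣   ≡⟨ sideToMid-≤ (m≤n⇒m≤1+n j≤l) ⟨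
    sideToMid j (suc l) ≡⟨ e ⟩
    2 + _               ∎)
  where open ≡-Reasoning
geodesic-step-mid {l = k} {mid l} vk vl e with toward {k} {l} e
... | m , km , ml , m≤ = mid m , ≤-trans (s≤s (s≤s m≤)) (⊔-lub vk vl) , km , ml

geodesic-step : ∀ {p a b} → Valid p a → Valid p b → GeodesicStep p a b
geodesic-step {a = apex}     _  = geodesic-step-apex
geodesic-step {a = side _ _} va = geodesic-step-side va
geodesic-step {a = mid _}    va = geodesic-step-mid va

apex-geodesic-on-side : ∀ {s i} c → c ≢ apex → dist apex c + dist c (side s i) ≡ suc i →
                        ∃ λ k → c ≡ side s k
apex-geodesic-on-side apex c≢apex _ = contradiction refl c≢apex
apex-geodesic-on-side {s} {i} (side t k) _ e with t ≟ˢ s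
... | yes refl = k , refl
... | no t≢s   = contradiction e (>⇒≢ (begin-strict
  suc i                      ≤⟨ s≤s (m≤n+∣n-m∣ i k) ⟩
  suc (k + ∣ k - i ∣)        <⟨ s≤s (+-monoʳ-< k (s≤s (m≤m⊔n ∣ k - i ∣ 1))) ⟩
  suc k + suc (∣ k - i ∣ ⊔ 1) ≡⟨ cong (suc k +_) (dist-opposite-sides t≢s k i) ⟨
  suc k + dist (side t k) (side s i) ∎))
  where open ≤-Reasoning
apex-geodesic-on-side {s} {i} (mid l) _ e = contradiction e (>⇒≢ (begin-strict
  suc i                      ≤⟨ s≤s (m≤n+∣n-m∣ i l) ⟩
  suc (l + ∣ l - i ∣)        ≡⟨ cong (λ t → suc (l + t)) (∣-∣-comm l i) ⟩
  suc (l + ∣ i - l ∣)        ≤⟨ s≤s (+-monoʳ-≤ l (∣i-l∣≤sideToMid i l)) ⟩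
  suc (l + sideToMid i l)    <⟨ n<1+n _ ⟩
  2 + l + sideToMid i l      ∎))
  where open ≤-Reasoning

pathPoint : ℕ → Point
pathPoint zero    = apex
pathPoint (suc l) = mid l

module Enumeration (p : ℕ) where

  point₂ : Fin p ⊎ Fin (2 * p) → Point
  point₂ (inj₁ j) = side Z (toℕ j)
  point₂ (inj₂ r) = pathPoint (toℕ r)

  point₃ : Fin p ⊎ Fin (3 * p) → Point
  point₃ (inj₁ i) = side Y (toℕ i)
  point₃ (inj₂ g) = point₂ (splitAt p g)

  point : Fin (4 * p) → Point
  point f = point₃ (splitAt p f)

  pathPoint-valid : ∀ {n} → n < 2 * p → Valid p (pathPoint n)
  pathPoint-valid {zero}  n<2p = n<2p
  pathPoint-valid {suc _} n<2p = n<2p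

  point₂-valid : ∀ s → Valid p (point₂ s)
  point₂-valid (inj₁ j) = toℕ<n j
  point₂-valid (inj₂ r) = pathPoint-valid (toℕ<n r)

  point₃-valid : ∀ s → Valid p (point₃ s)
  point₃-valid (inj₁ i) = toℕ<n i
  point₃-valid (inj₂ g) = point₂-valid (splitAt p g)

  point-valid : ∀ f → Valid p (point f)
  point-valid f = point₃-valid (splitAt p f)

  vertex₂ : Fin p ⊎ Fin (2 * p) → Fin (4 * p)
  vertex₂ = join p (3 * p) ∘ inj₂ ∘ join p (2 * p)

  vertex : ∀ a → .(Valid p a) → Fin (4 * p)
  vertex (side Y i) v = join p (3 * p) (inj₁ (fromℕ< v))
  vertex (side Z j) v = vertex₂ (inj₁ (fromℕ< v))
  vertex apex       v = vertex₂ (inj₂ (fromℕ< v))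
  vertex (mid l)    v = vertex₂ (inj₂ (fromℕ< v))

  point-vertex₂ : ∀ s → point (vertex₂ s) ≡ point₂ s
  point-vertex₂ s = trans (cong point₃ (splitAt-join p (3 * p) (inj₂ (join p (2 * p) s))))
                          (cong point₂ (splitAt-join p (2 * p) s))

  point-vertex : ∀ a .(v : Valid p a) → point (vertex a v) ≡ a
  point-vertex (side Y i) v = trans (cong point₃ (splitAt-join p (3 * p) (inj₁ (fromℕ< v))))
                                    (cong (side Y) (toℕ-fromℕ< v))
  point-vertex (side Z j) v = trans (point-vertex₂ (inj₁ (fromℕ< v))) (cong (side Z) (toℕ-fromℕ< v))
  point-vertex apex       v = trans (point-vertex₂ (inj₂ (fromℕ< v))) (cong pathPoint (toℕ-fromℕ< v))
  point-vertex (mid l)    v = trans (point-vertex₂ (inj₂ (fromℕ< v))) (cong pathPoint (toℕ-fromℕ< v))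

  private
    vertex-pathPoint : ∀ {n} (n<2p : n < 2 * p) →
                       vertex (pathPoint n) (pathPoint-valid n<2p) ≡ vertex₂ (inj₂ (fromℕ< n<2p))
    vertex-pathPoint {zero}  _ = refl
    vertex-pathPoint {suc _} _ = refl

    vertex-point₂ : ∀ s → vertex (point₂ s) (point₂-valid s) ≡ vertex₂ s
    vertex-point₂ (inj₁ j) = cong (vertex₂ ∘ inj₁) (fromℕ<-toℕ j _)
    vertex-point₂ (inj₂ r) = trans (vertex-pathPoint (toℕ<n r)) (cong (vertex₂ ∘ inj₂) (fromℕ<-toℕ r _))

    vertex-point₃ : ∀ s → vertex (point₃ s) (point₃-valid s) ≡ join p (3 * p) s
    vertex-point₃ (inj₁ i) = cong (join p (3 * p) ∘ inj₁) (fromℕ<-toℕ i _)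
    vertex-point₃ (inj₂ g) =
      trans (vertex-point₂ (splitAt p g)) (cong (join p (3 * p) ∘ inj₂) (join-splitAt p (2 * p) g))

  vertex-point : ∀ f → vertex (point f) (point-valid f) ≡ f
  vertex-point f = trans (vertex-point₃ (splitAt p f)) (join-splitAt p (3 * p) f)

  point-injective : ∀ {f g} → point f ≡ point g → f ≡ g
  point-injective {f} {g} fg = trans (sym (vertex-point f)) (trans (cong-vertex fg) (vertex-point g))
    where
    cong-vertex : ∀ {a b} .{v : Valid p a} .{w : Valid p b} → a ≡ b → vertex a v ≡ vertex b w
    cong-vertex refl = refl

-- Gₚ is given by its metric: its edges are the pairs of vertices at distance 1.
Gₚ : ∀ p → GraphMetric (4 * p)
Gₚ p = record
  { d           = λ f g → dist (point f) (point g)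
  ; d-sym       = λ f g → dist-sym (point f) (point g)
  ; d-refl      = λ f → dist-refl (point f)
  ; d≡0⇒≡       = point-injective ∘ dist≡0⇒≡
  ; d-lipschitz = λ {f} {h} g → dist-lipschitz {point f} {point h} (point g)
  ; d-geodesic  = λ {f} {g} fg →
      let c , vc , ac , cb = geodesic-step (point-valid f) (point-valid g) fg
          pc≡c = sym (point-vertex c vc)
      in vertex c vc , subst (λ x → dist (point f) x ≡ 1) pc≡c ac ,
                       subst (λ x → dist x (point g) ≡ _) pc≡c cb
  }
  where open Enumeration p

module Construction (q : ℕ) where

  p : ℕ
  p = suc q

  open Enumeration p
  open GraphMetric (Gₚ p) public

  α₂-metric : Alpha2Metric graph
  α₂-metric = alpha2Metric (λ {u} {v} {w} {x} → α₂ {u} {v} {w} {x})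
    where
    open HeightBounds d (height ∘ point) d-sym d-triangle
      (λ f g → ∣height-height∣≤2*dist (point f) (point g))
      (λ {f} {g} → 2*dist≤∣height-height∣+2 {point f} {point g})
      (λ {f} {g} → dist-level≤2 {point f} {point g})
      (λ {f} {g} → dist≡1⇒height≢height {point f} {point g})

  x₀ : Fin (4 * p)
  x₀ = vertex apex (s≤s z≤n)

  top : Side → Fin (4 * p)
  top s = vertex (side s q) ≤-refl

  y z : Fin (4 * p)
  y = top Y
  z = top Z

  point-x₀ : point x₀ ≡ apex
  point-x₀ = point-vertex apex (s≤s z≤n)

  point-top : ∀ s → point (top s) ≡ side s q
  point-top s = point-vertex (side s q) ≤-refl

  x₀-to-top : ∀ s → Dist graph x₀ (top s) p
  x₀-to-top s = subst (Dist graph x₀ (top s)) (cong₂ dist point-x₀ (point-top s)) (d-is-Dist x₀ (top s))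

  d-y-z : d y z ≡ 2
  d-y-z = trans (cong₂ dist (point-top Y) (point-top Z)) (cong (λ t → suc (t ⊔ 1)) (∣n-n∣≡0 q))

  y-to-z : Dist graph y z 2
  y-to-z = subst (Dist graph y z) d-y-z (d-is-Dist y z)

  on-side : ∀ s {c} → InIo graph x₀ (top s) c → ∃ λ k → point c ≡ side s k
  on-side s {c} (c∈I , c≢x₀ , _) = apex-geodesic-on-side (point c)
    (λ pc≡apex → c≢x₀ (point-injective (trans pc≡apex (sym point-x₀))))
    (subst₂ (λ a b → dist a (point c) + dist (point c) b ≡ dist a b)
            point-x₀ (point-top s) (InI⇒d+d≡d c∈I))

  far-from-top : ∀ {s k} c t → s ≢ t → point c ≡ side s k → 1 < d c (top t)
  far-from-top {s} {k} c t s≢t pc =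
    subst₂ (λ a b → 1 < dist a b) (sym pc) (sym (point-top t)) (opposite-sides-far s≢t k q)

  metric-triangle : MetricTriangle graph x₀ y z
  metric-triangle = x₀y∩yz , yz∩zx₀ , zx₀∩x₀y
    where
    x₀y∩yz : Disjoint graph (InIo graph x₀ y) (InIo graph y z)
    x₀y∩yz c c∈x₀y c∈yz = <⇒≢ (far-from-top c Z (λ ()) (proj₂ (on-side Y c∈x₀y)))
      (sym (proj₂ (InIo-at-distance-2 d-y-z c∈yz)))

    yz∩zx₀ : Disjoint graph (InIo graph y z) (InIo graph z x₀)
    yz∩zx₀ c c∈yz c∈zx₀ = <⇒≢ (far-from-top c Y (λ ()) (proj₂ (on-side Z (InIo-sym c∈zx₀))))
      (sym (trans (d-sym c y) (proj₁ (InIo-at-distance-2 d-y-z c∈yz))))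

    zx₀∩x₀y : Disjoint graph (InIo graph z x₀) (InIo graph x₀ y)
    zx₀∩x₀y c c∈zx₀ c∈x₀y
      with trans (sym (proj₂ (on-side Z (InIo-sym c∈zx₀)))) (proj₂ (on-side Y c∈x₀y))
    ... | ()

lemma7 : (p : ℕ) → 2 ≤ p →
    Σ (Graph (4 * p)) λ G →
      Connected G × Alpha2Metric G ×
      Σ (Fin (4 * p)) λ x₀ → Σ (Fin (4 * p)) λ y → Σ (Fin (4 * p)) λ z →
        MetricTriangle G x₀ y z × Dist G x₀ y p × Dist G x₀ z p × Dist G y z 2
lemma7 (suc q) _ =
  graph , connected , α₂-metric , x₀ , y , z , metric-triangle , x₀-to-top Y , x₀-to-top Z , y-to-z
  where open Construction q
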